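{- Every outerplanar graph is $3$-defective $2$-correspondable. Furthermore, $3$ defects is best possible: there exists an outerplanar graph that is not $2$-defective $2$-correspondable.
   Context: All graphs are finite, simple and undirected. A graph is outerplanar if it can be embedded in the plane with all vertices on the boundary of the outer face. A correspondence cover of a graph $G$ is a pair $\mathcal{H}=(L,H)$ where $H$ is a graph and $L: V(G)\to 2^{V(H)}$ satisfies: (1) $\{L(v): v\in V(G)\}$ partitions $V(H)$; (2) each $L(v)$ is an independent set in $H$; (3) for all $u,v\in V(G)$, the edges of $H[L(u)\cup L(v)]$ form a matching, which is empty if $uv\notin E(G)$. The cover is $k$-fold if $|L(v)|\ge k$ for all $v$. Two colors conflict if they are adjacent in $H$. An $\mathcal{H}$-coloring is a map $\phi:V(G)\to V(H)$ with $\phi(v)\in L(v)$ for all $v$; it is $d$-defective if the subgraph of $H$ induced by the image of $\phi$ has maximum degree at most $d$. A graph is $d$-defective $k$-correspondable if it has a $d$-defective $\mathcal{H}$-coloring for every $k$-fold correspondence cover $\mathcal{H}$. -}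

module Defs where

open import Data.Nat using (ℕ; _≤_; _<_)
open import Data.Fin using (Fin; toℕ)
open import Data.Bool using (Bool; true; false; T; if_then_else_)
open import Data.List using (List; map; allFin)
open import Data.Nat.ListAction using (sum)
open import Data.Product using (Σ; _×_; _,_)
open import Relation.Binary.PropositionalEquality using (_≡_)
open import Relation.Nullary using (¬_)
open import Function.Definitions using (Injective)

record Graph : Set where
  field
    n     : ℕ
    adj   : Fin n → Fin n → Bool
    sym   : ∀ u v → adj u v ≡ adj v u
    irrefl : ∀ u → adj u u ≡ false
open Graph public

-- Outerplanarity, combinatorially: the vertices can be placed in convex
-- position (positions pos : Fin n ↪ Fin n around a circle) such that no two
-- edges, drawn as chords, cross; i.e. no edges ab, cd with
-- pos a < pos c < pos b < pos d.
Outerplanar : Graph → Set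
Outerplanar G =
  Σ (Fin (n G) → Fin (n G)) λ pos →
    Injective _≡_ _≡_ pos ×
    (∀ a b c d → adj G a b ≡ true → adj G c d ≡ true →
      ¬ (toℕ (pos a) < toℕ (pos c) × toℕ (pos c) < toℕ (pos b) × toℕ (pos b) < toℕ (pos d)))

-- V(H) is the disjoint union of the
-- lists L(v) = {v} × Fin (size v) (so condition (1), partition, holds by
-- construction); conf is the adjacency ("conflict") relation of H.
record Cover (G : Graph) (k : ℕ) : Set where
  field
    size     : Fin (n G) → ℕ
    k-fold   : ∀ v → k ≤ size v
    conf     : (u : Fin (n G)) → Fin (size u) → (v : Fin (n G)) → Fin (size v) → Bool
    -- H is a simple undirected graph (symmetric; loops excluded by `indep`)
    conf-sym : ∀ u a v b → conf u a v b ≡ conf v b u a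
    indep    : ∀ v a b → conf v a v b ≡ false
    -- (3) edges between L(u) and L(v) form a matching (each colour conflicts
    -- with at most one colour of another list; the other side follows by conf-sym) ...
    matching : ∀ u a v b b′ → conf u a v b ≡ true → conf u a v b′ ≡ true → b ≡ b′
    nonadj   : ∀ u a v b → adj G u v ≡ false → conf u a v b ≡ false
open Cover public

Colouring : {G : Graph} {k : ℕ} → Cover G k → Set
Colouring {G} 𝓗 = (v : Fin (n G)) → Fin (size 𝓗 v)

-- Degree of the colour φ(v) in the subgraph of H induced by the image of φ.
-- (Distinct vertices of G have distinct colours, so the image is exactly
-- {φ(u) : u ∈ V(G)}.)
imageDegree : {G : Graph} {k : ℕ} (𝓗 : Cover G k) → Colouring 𝓗 → Fin (n G) → ℕ
imageDegree {G} 𝓗 φ v =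
  sum (map (λ u → if conf 𝓗 v (φ v) u (φ u) then 1 else 0) (allFin (n G)))

Defective : {G : Graph} {k : ℕ} (𝓗 : Cover G k) → ℕ → Colouring 𝓗 → Set
Defective {G} 𝓗 d φ = ∀ v → imageDegree 𝓗 φ v ≤ d

DefectiveCorrespondable : ℕ → ℕ → Graph → Set
DefectiveCorrespondable d k G =
  (𝓗 : Cover G k) → Σ (Colouring 𝓗) λ φ → Defective 𝓗 d φ

module Submission where

-- Draw G with its vertices on a circle and call an interval (a, b) closed when no vertex strictly inside it
-- has a neighbour outside [a, b]. A closed interval with non-empty interior splits at an interior vertex c
-- into closed intervals (a, c) and (c, b): take for c the last interior neighbour of a, or the first interior
-- vertex when a has none (planarity rules out the crossing edges). By induction on intervals, the interior
-- of a closed interval can be recoloured so that its vertices have at most 3 conflicts while one prescribed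
-- end has no conflict with the interior and the other end at most one. For the induction step, c takes a
-- colour avoiding the prescribed end, which is possible since lists have at least two colours and conflicts form
-- matchings, and the ends to protect in the two halves are chosen so that c collects at most 3 conflicts.
-- The interval from the first to the last vertex then gives a 3-defective colouring.
--
-- For sharpness, join a hub to three copies of the path x₀x₁x₂x₃x₄ with chord x₁x₃, the hub seeing all of
-- them but x₂, in the cover where the ends of x₁x₂ conflict when their colours differ and those of any other
-- edge when they agree. If the hub conflicted with none of x₀, x₁, x₃, x₄, these would all get the colour
-- opposite to the hub's, and then x₁ (if x₂ differs from it) or x₃ (otherwise) would have three conflicts.
-- So in a 2-defective colouring every copy gives the hub a conflict, and the hub has three.

open import Defs hiding (sym)

open import Data.Bool using (Bool; true; false; if_then_else_; _∧_; _∨_; _xor_; T)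
open import Data.Bool.Properties using () renaming (_≟_ to _≟ᵇ_)
open import Data.Empty using (⊥-elim)
open import Data.Fin using (Fin; zero; suc; toℕ; punchIn; combine; remQuot; _≟_)
open import Data.Fin.Patterns using (0F; 1F; 2F; 3F; 4F)
open import Data.Fin.Properties using (punchInᵢ≢i; toℕ-injective; all?)
open import Data.List using (List; []; _∷_; _++_; map; tabulate; allFin; filter)
open import Data.List.Extrema.Nat
  using (argmax; argmin; argmax-all; argmin-all; f[⊥]≤f[argmax]; f[xs]≤f[argmax]; f[argmin]≤f[⊤]; f[argmin]≤f[xs])
open import Data.List.Membership.Propositional using (_∈_)
open import Data.List.Membership.Propositional.Properties using (∈-filter⁺; ∈-allFin)
open import Data.List.Properties using (map-tabulate)
open import Data.List.Relation.Unary.All using (_∷_; lookup)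
open import Data.List.Relation.Unary.All.Properties using (all-filter)
open import Data.List.Relation.Unary.Any using (here; there)
open import Data.Nat using (ℕ; zero; suc; _+_; _≤_; _<_; _≤?_; _<?_; z≤n; s≤s)
open import Data.Nat.ListAction using (sum)
open import Data.Nat.ListAction.Properties using (sum-++)
open import Data.Nat.Properties
  using ( ≤-refl; ≤-reflexive; ≤-trans; ≤-antisym; ≤-pred; <⇒≤; <-trans; <-cmp; ≮⇒≥; <⇒≱; m≤n⇒m<n∨m≡n
        ; +-mono-≤; +-monoʳ-≤; +-monoˡ-≤; +-identityʳ; +-suc; m≤m+n; +-0-commutativeMonoid; module ≤-Reasoning)
open import Algebra.Properties.CommutativeMonoid.Sum +-0-commutativeMonoid
  using (∑-distrib-+; sum-cong-≗; sum-remove; sum-replicate-zero) renaming (sum to ∑)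
open import Data.Product using (Σ; Σ-syntax; ∃-syntax; _×_; _,_; proj₁; proj₂; uncurry)
open import Data.Sum using (_⊎_; inj₁; inj₂)
open import Data.Vec.Functional using () renaming ([] to []ᵛ; _∷_ to _∷ᵛ_)
open import Function using (_∘_; id; case_of_)
open import Level using (Level; 0ℓ)
open import Relation.Binary.Definitions using (tri<; tri≈; tri>)
open import Relation.Binary.PropositionalEquality using (_≡_; _≢_; refl; sym; trans; cong; cong₂; subst)
open import Relation.Nullary using (¬_; does; yes; no; contradiction; ¬?; _×-dec_; _→-dec_)
open import Relation.Nullary.Decidable using (T?; from-yes)
open import Relation.Unary using (Pred; Decidable; _⊆_; _∪_; _∩_)
open import Relation.Unary.Properties using (_∪?_; _∩?_; U?)

private
  variable
    m : ℕ
    ℓ ℓ′ ℓ″ : Level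
    P : Pred (Fin m) ℓ
    Q : Pred (Fin m) ℓ′
    R : Pred (Fin m) ℓ″

𝟙 : Bool → ℕ
𝟙 b = if b then 1 else 0

𝟙≤1 : ∀ b → 𝟙 b ≤ 1
𝟙≤1 true  = s≤s z≤n
𝟙≤1 false = z≤n

∑-mono : {f g : Fin m → ℕ} → (∀ i → f i ≤ g i) → ∑ f ≤ ∑ g
∑-mono {zero}  f≤g = z≤n
∑-mono {suc m} f≤g = +-mono-≤ (f≤g zero) (∑-mono (f≤g ∘ suc))

∑-zero : {f : Fin m → ℕ} → (∀ i → f i ≡ 0) → ∑ f ≡ 0
∑-zero {m} f≡0 = trans (sum-cong-≗ f≡0) (sum-replicate-zero m)

∑-single : (f : Fin m → ℕ) (k : Fin m) → (∀ i → i ≢ k → f i ≡ 0) → ∑ f ≡ f k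
∑-single {suc m} f k f≡0 = trans (sum-remove {i = k} f)
  (trans (cong (f k +_) (∑-zero (λ j → f≡0 (punchIn k j) (punchInᵢ≢i k j)))) (+-identityʳ (f k)))

sum-map-allFin : (f : Fin m → ℕ) → sum (map f (allFin m)) ≡ ∑ f
sum-map-allFin f = trans (cong sum (map-tabulate id f)) (sum-tabulate f)
  where
  sum-tabulate : ∀ {m} (f : Fin m → ℕ) → sum (tabulate f) ≡ ∑ f
  sum-tabulate {zero}  f = refl
  sum-tabulate {suc m} f = cong (f zero +_) (sum-tabulate (f ∘ suc))

count : Decidable P → ℕ
count P? = ∑ λ i → 𝟙 (does (P? i))

count-mono : (P? : Decidable P) (Q? : Decidable Q) → P ⊆ Q → count P? ≤ count Q?
count-mono P? Q? P⊆Q = ∑-mono pointwise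
  where
  pointwise : ∀ i → 𝟙 (does (P? i)) ≤ 𝟙 (does (Q? i))
  pointwise i with P? i | Q? i
  ... | yes Pi | no ¬Qi = contradiction (P⊆Q Pi) ¬Qi
  ... | yes _  | yes _  = ≤-refl
  ... | no _   | _      = z≤n

count-cong : (P? : Decidable P) (Q? : Decidable Q) → P ⊆ Q → Q ⊆ P → count P? ≡ count Q?
count-cong P? Q? P⊆Q Q⊆P = ≤-antisym (count-mono P? Q? P⊆Q) (count-mono Q? P? Q⊆P)

count-∪ : (P? : Decidable P) (Q? : Decidable Q) → count (P? ∪? Q?) ≤ count P? + count Q?
count-∪ P? Q? = ≤-trans (∑-mono (λ i → 𝟙-∨ (does (P? i)) (does (Q? i))))
                        (≤-reflexive (∑-distrib-+ (λ i → 𝟙 (does (P? i))) (λ i → 𝟙 (does (Q? i)))))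
  where
  𝟙-∨ : ∀ x y → 𝟙 (x ∨ y) ≤ 𝟙 x + 𝟙 y
  𝟙-∨ true  y = s≤s z≤n
  𝟙-∨ false y = ≤-refl

count-⊆-∪ : (P? : Decidable P) (Q? : Decidable Q) (R? : Decidable R) →
            P ⊆ Q ∪ R → count P? ≤ count Q? + count R?
count-⊆-∪ P? Q? R? P⊆Q∪R = ≤-trans (count-mono P? (Q? ∪? R?) P⊆Q∪R) (count-∪ Q? R?)

count-empty : (P? : Decidable P) → (∀ i → ¬ P i) → count P? ≡ 0
count-empty P? ∅ = ∑-zero pointwise
  where
  pointwise : ∀ i → 𝟙 (does (P? i)) ≡ 0
  pointwise i with P? i
  ... | yes Pi = contradiction Pi (∅ i)
  ... | no _   = refl

count-at : (P? : Decidable P) (k : Fin m) → count ((_≟ k) ∩? P?) ≡ 𝟙 (does (P? k))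
count-at P? k = trans (∑-single _ k elsewhere) at-k
  where
  elsewhere : ∀ i → i ≢ k → 𝟙 (does (((_≟ k) ∩? P?) i)) ≡ 0
  elsewhere i i≢k with i ≟ k
  ... | yes i≡k = contradiction i≡k i≢k
  ... | no _    = refl
  at-k : 𝟙 (does (((_≟ k) ∩? P?) k)) ≡ 𝟙 (does (P? k))
  at-k with k ≟ k
  ... | yes _  = refl
  ... | no k≢k = contradiction refl k≢k

module _ {m ℓ} {P : Pred (Fin m) ℓ} (P? : Decidable P) (f : Fin m → ℕ) where

  private
    candidate : ∀ {y} → P y → y ∈ filter P? (allFin m)
    candidate Py = ∈-filter⁺ P? (∈-allFin _) Py

  maximum? : (∃[ x ] P x × ∀ {y} → P y → f y ≤ f x) ⊎ (∀ y → ¬ P y)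
  maximum? with filter P? (allFin m) | all-filter P? (allFin m) | candidate
  ... | []     | _         | cand = inj₂ λ y Py → case cand Py of λ ()
  ... | x ∷ xs | Px ∷ Pxs  | cand = inj₁ (argmax f x xs , argmax-all f Px Pxs , λ Py → bound (cand Py))
    where
    bound : ∀ {y} → y ∈ x ∷ xs → f y ≤ f (argmax f x xs)
    bound (here refl)  = f[⊥]≤f[argmax] {f = f} x xs
    bound (there y∈xs) = lookup (f[xs]≤f[argmax] {f = f} x xs) y∈xs

  minimum? : (∃[ x ] P x × ∀ {y} → P y → f x ≤ f y) ⊎ (∀ y → ¬ P y)
  minimum? with filter P? (allFin m) | all-filter P? (allFin m) | candidate
  ... | []     | _         | cand = inj₂ λ y Py → case cand Py of λ ()
  ... | x ∷ xs | Px ∷ Pxs  | cand = inj₁ (argmin f x xs , argmin-all f Px Pxs , λ Py → bound (cand Py))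
    where
    bound : ∀ {y} → y ∈ x ∷ xs → f (argmin f x xs) ≤ f y
    bound (here refl)  = f[argmin]≤f[⊤] {f = f} x xs
    bound (there y∈xs) = lookup (f[argmin]≤f[xs] {f = f} x xs) y∈xs

two-distinct : 2 ≤ m → Σ[ x ∈ Fin m ] Σ[ y ∈ Fin m ] x ≢ y
two-distinct (s≤s (s≤s _)) = zero , suc zero , λ ()

module Conflicts {G : Graph} {k : ℕ} (H : Cover G k) where

  conflict : Colouring H → Fin (n G) → Fin (n G) → Bool
  conflict φ v u = conf H v (φ v) u (φ u)

  Conflict : Colouring H → Fin (n G) → Pred (Fin (n G)) 0ℓ
  Conflict φ v u = T (conflict φ v u)

  Conflict? : ∀ φ v → Decidable (Conflict φ v)
  Conflict? φ v u = T? (conflict φ v u)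

  degree : Colouring H → Fin (n G) → ℕ
  degree φ v = count (Conflict? φ v)

  imageDegree≡degree : ∀ φ v → imageDegree H φ v ≡ degree φ v
  imageDegree≡degree φ v = sum-map-allFin (𝟙 ∘ conflict φ v)

  conflict-sym : ∀ φ v u → conflict φ v u ≡ conflict φ u v
  conflict-sym φ v u = conf-sym H v (φ v) u (φ u)

  conflict-irrefl : ∀ φ v → conflict φ v v ≡ false
  conflict-irrefl φ v = indep H v (φ v) (φ v)

  Conflict⇒adj : ∀ {φ v u} → Conflict φ v u → adj G v u ≡ true
  Conflict⇒adj {φ} {v} {u} c with adj G v u in e
  ... | true  = refl
  ... | false = ⊥-elim (subst T (nonadj H v (φ v) u (φ u) e) c)

  degree-local : ∀ {φ ψ v} → φ v ≡ ψ v → (∀ {u} → adj G v u ≡ true → φ u ≡ ψ u) → degree φ v ≡ degree ψ v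
  degree-local {φ} {ψ} {v} φv≡ψv agree = count-cong (Conflict? φ v) (Conflict? ψ v) 
    (transport φv≡ψv agree) (transport (sym φv≡ψv) (sym ∘ agree))
    where
    transport : ∀ {φ ψ} → φ v ≡ ψ v → (∀ {u} → adj G v u ≡ true → φ u ≡ ψ u) → Conflict φ v ⊆ Conflict ψ v
    transport φv≡ψv agree {u} c = subst T (cong₂ (λ x y → conf H v x u y) φv≡ψv (agree (Conflict⇒adj c))) c

  _[_≔_] : (φ : Colouring H) (v : Fin (n G)) → Fin (size H v) → Colouring H
  (φ [ v ≔ x ]) u with u ≟ v
  ... | yes refl = x
  ... | no _     = φ u

  update-same : ∀ φ v x → (φ [ v ≔ x ]) v ≡ x
  update-same φ v x with v ≟ v
  ... | yes refl = refl
  ... | no v≢v   = contradiction refl v≢v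

  update-other : ∀ φ {v} x {u} → u ≢ v → (φ [ v ≔ x ]) u ≡ φ u
  update-other φ {v} x {u} u≢v with u ≟ v
  ... | yes u≡v = contradiction u≡v u≢v
  ... | no _    = refl

  avoiding-colour : 2 ≤ k → ∀ v w (y : Fin (size H w)) → ∃[ x ] conf H v x w y ≡ false
  avoiding-colour 2≤k v w y with two-distinct (≤-trans 2≤k (k-fold H v))
  ... | x₀ , x₁ , x₀≢x₁ with conf H v x₀ w y in e₀ | conf H v x₁ w y in e₁
  ...   | false | _     = x₀ , e₀
  ...   | true  | false = x₁ , e₁
  ...   | true  | true  = contradiction
    (matching H w y v x₀ x₁ (trans (conf-sym H w y v x₀) e₀) (trans (conf-sym H w y v x₁) e₁)) x₀≢x₁

module Intervals {G : Graph} (outerplanar : Outerplanar G) where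

  pos : Fin (n G) → ℕ
  pos v = toℕ (proj₁ outerplanar v)

  pos-injective : ∀ {u v} → pos u ≡ pos v → u ≡ v
  pos-injective = proj₁ (proj₂ outerplanar) ∘ toℕ-injective

  noncrossing : ∀ {a b c d} → adj G a b ≡ true → adj G c d ≡ true →
                ¬ (pos a < pos c × pos c < pos b × pos b < pos d)
  noncrossing = proj₂ (proj₂ outerplanar) _ _ _ _

  adj-sym : ∀ {u w} → adj G u w ≡ true → adj G w u ≡ true
  adj-sym {u} {w} uw = trans (Graph.sym G w u) uw

  Inside : Fin (n G) → Fin (n G) → Pred (Fin (n G)) 0ℓ
  Inside a b u = pos a < pos u × pos u < pos b

  Inside? : ∀ a b → Decidable (Inside a b)
  Inside? a b u = pos a <? pos u ×-dec pos u <? pos b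

  Closed : Fin (n G) → Fin (n G) → Set
  Closed a b = ∀ {u w} → Inside a b u → adj G u w ≡ true → pos a ≤ pos w × pos w ≤ pos b

  Inside-split : ∀ {a b c u} → Inside a b c → Inside a b u → Inside a c u ⊎ u ≡ c ⊎ Inside c b u
  Inside-split {c = c} {u} (a<c , c<b) (a<u , u<b) with <-cmp (pos u) (pos c)
  ... | tri< u<c _ _ = inj₁ (a<u , u<c)
  ... | tri≈ _ u≡c _ = inj₂ (inj₁ (pos-injective u≡c))
  ... | tri> _ _ c<u = inj₂ (inj₂ (c<u , u<b))

  between : ∀ {a b u} → pos a ≤ pos u → pos u ≤ pos b → Inside a b u ⊎ u ≡ a ⊎ u ≡ b
  between a≤u u≤b with m≤n⇒m<n∨m≡n a≤u | m≤n⇒m<n∨m≡n u≤b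
  ... | inj₂ a≡u | _        = inj₂ (inj₁ (pos-injective (sym a≡u)))
  ... | inj₁ _   | inj₂ u≡b = inj₂ (inj₂ (pos-injective u≡b))
  ... | inj₁ a<u | inj₁ u<b = inj₁ (a<u , u<b)

  outside-before : ∀ {a b u} → pos u ≤ pos a → ¬ Inside a b u
  outside-before u≤a (a<u , _) = <⇒≱ a<u u≤a

  outside-after : ∀ {a b u} → pos b ≤ pos u → ¬ Inside a b u
  outside-after b≤u (_ , u<b) = <⇒≱ u<b b≤u

  Inside-disjoint : ∀ {a b c u} → Inside a c u → ¬ Inside c b u
  Inside-disjoint (_ , u<c) = outside-before (<⇒≤ u<c)

  Inside-left : ∀ {a b c} → Inside a b c → Inside a c ⊆ Inside a b
  Inside-left (_ , c<b) (a<u , u<c) = a<u , <-trans u<c c<b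

  Inside-right : ∀ {a b c} → Inside a b c → Inside c b ⊆ Inside a b
  Inside-right (a<c , _) (c<u , u<b) = <-trans a<c c<u , u<b

  closed-unreachable-before : ∀ {a b w} → Closed a b → pos w < pos a → ∀ {u} → Inside a b u → adj G w u ≢ true
  closed-unreachable-before closed w<a u∈ wu = <⇒≱ w<a (proj₁ (closed u∈ (adj-sym wu)))

  closed-unreachable-after : ∀ {a b w} → Closed a b → pos b < pos w → ∀ {u} → Inside a b u → adj G w u ≢ true
  closed-unreachable-after closed b<w u∈ wu = <⇒≱ b<w (proj₂ (closed u∈ (adj-sym wu)))

  closed-left : ∀ {a b c} → Closed a b → Inside a b c → adj G a c ≡ true → Closed a c
  closed-left closed (_ , c<b) ac (a<u , u<c) uw =
    proj₁ (closed (a<u , <-trans u<c c<b) uw) , ≮⇒≥ λ c<w → noncrossing ac uw (a<u , u<c , c<w)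

  closed-right : ∀ {a b c} → Closed a b → Inside a b c →
                 (∀ {w u} → pos a ≤ pos w → pos w < pos c → Inside c b u → adj G w u ≢ true) → Closed c b
  closed-right closed (a<c , _) separated (c<u , u<b) uw with closed (<-trans a<c c<u , u<b) uw
  ... | a≤w , w≤b = ≮⇒≥ (λ w<c → separated a≤w w<c (c<u , u<b) (adj-sym uw)) , w≤b

  split : ∀ {a b} → Closed a b → (∀ u → ¬ Inside a b u) ⊎ (∃[ c ] Inside a b c × Closed a c × Closed c b)
  split {a} {b} closed with maximum? (Inside? a b ∩? λ u → adj G a u ≟ᵇ true) pos
  ... | inj₁ (c , (c∈ , ac) , c-last) =
    inj₂ (c , c∈ , closed-left closed c∈ ac , closed-right closed c∈ separated)
    where
    separated : ∀ {w u} → pos a ≤ pos w → pos w < pos c → Inside c b u → adj G w u ≢ true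
    separated a≤w w<c (c<u , u<b) wu with m≤n⇒m<n∨m≡n a≤w
    ... | inj₁ a<w = noncrossing ac wu (a<w , w<c , c<u)
    ... | inj₂ a≡w with pos-injective a≡w
    ...   | refl = <⇒≱ c<u (c-last ((<-trans (proj₁ c∈) c<u , u<b) , wu))
  ... | inj₂ a-isolated with minimum? (Inside? a b) pos
  ...   | inj₂ empty = inj₁ empty
  ...   | inj₁ (c , c∈ , c-first) = inj₂ (c , c∈ , nothing-before , closed-right closed c∈ separated)
    where
    nothing-before : Closed a c
    nothing-before (a<u , u<c) _ = contradiction (c-first (a<u , <-trans u<c (proj₂ c∈))) (<⇒≱ u<c)
    separated : ∀ {w u} → pos a ≤ pos w → pos w < pos c → Inside c b u → adj G w u ≢ true
    separated a≤w w<c (c<u , u<b) wu with m≤n⇒m<n∨m≡n a≤w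
    ... | inj₁ a<w = <⇒≱ w<c (c-first (a<w , <-trans w<c (proj₂ c∈)))
    ... | inj₂ a≡w with pos-injective a≡w
    ...   | refl = a-isolated _ ((<-trans (proj₁ c∈) c<u , u<b) , wu)

data End : Set where
  left right : End

budget : End → End → ℕ
budget left  left  = 0
budget left  right = 1
budget right left  = 1
budget right right = 0

protected-conflict : End → Bool → Bool → Bool
protected-conflict left  ea _  = ea
protected-conflict right _  eb = eb

-- c avoids the colour of the protected end; in the other half the outer end is protected when c conflicts
-- with it, and c itself otherwise.
left-protection : End → Bool → End
left-protection left  _     = left
left-protection right true  = left
left-protection right false = right

right-protection : End → Bool → End
right-protection right _     = right
right-protection left  true  = right
right-protection left  false = left

budget-split : ∀ s ea eb → protected-conflict s ea eb ≡ false →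
  budget (left-protection s ea) left + 𝟙 ea ≤ budget s left ×
  𝟙 eb + budget (right-protection s eb) right ≤ budget s right ×
  budget (left-protection s ea) right + budget (right-protection s eb) left + (𝟙 ea + 𝟙 eb) ≤ 3
budget-split left  false true  _ = z≤n , ≤-refl , ≤-refl
budget-split left  false false _ = z≤n , ≤-refl , s≤s z≤n
budget-split right true  false _ = ≤-refl , z≤n , ≤-refl
budget-split right false false _ = ≤-refl , z≤n , s≤s z≤n

module IntervalRecolouring {G : Graph} (outerplanar : Outerplanar G) {k : ℕ} (H : Cover G k) where
  open Intervals {G} outerplanar
  open Conflicts H
  open ≤-Reasoning

  load : Colouring H → Fin (n G) → Fin (n G) → Fin (n G) → ℕ
  load φ v a b = count (Inside? a b ∩? Conflict? φ v)

  degree-within : ∀ {φ v a b} → (∀ {u} → Conflict φ v u → pos a ≤ pos u × pos u ≤ pos b) →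
                  degree φ v ≤ load φ v a b + (𝟙 (conflict φ v a) + 𝟙 (conflict φ v b))
  degree-within {φ} {v} {a} {b} within = begin
    degree φ v
      ≤⟨ count-⊆-∪ C? (Inside? a b ∩? C?) (((_≟ a) ∩? C?) ∪? ((_≟ b) ∩? C?)) classify ⟩
    load φ v a b + count (((_≟ a) ∩? C?) ∪? ((_≟ b) ∩? C?))
      ≤⟨ +-monoʳ-≤ (load φ v a b) (count-∪ ((_≟ a) ∩? C?) ((_≟ b) ∩? C?)) ⟩
    load φ v a b + (count ((_≟ a) ∩? C?) + count ((_≟ b) ∩? C?))
      ≡⟨ cong (load φ v a b +_) (cong₂ _+_ (count-at C? a) (count-at C? b)) ⟩
    load φ v a b + (𝟙 (conflict φ v a) + 𝟙 (conflict φ v b)) ∎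
    where
    C? = Conflict? φ v
    classify : Conflict φ v ⊆ (Inside a b ∩ Conflict φ v) ∪ ((_≡ a) ∩ Conflict φ v) ∪ ((_≡ b) ∩ Conflict φ v)
    classify c with between (proj₁ (within c)) (proj₂ (within c))
    ... | inj₁ u∈        = inj₁ (u∈ , c)
    ... | inj₂ (inj₁ u≡a) = inj₂ (inj₁ (u≡a , c))
    ... | inj₂ (inj₂ u≡b) = inj₂ (inj₂ (u≡b , c))

  load-split : ∀ {φ v a b c} → Inside a b c →
               load φ v a b ≤ load φ v a c + (𝟙 (conflict φ v c) + load φ v c b)
  load-split {φ} {v} {a} {b} {c} c∈ = begin
    load φ v a b
      ≤⟨ count-⊆-∪ (Inside? a b ∩? C?) (Inside? a c ∩? C?) (((_≟ c) ∩? C?) ∪? (Inside? c b ∩? C?)) classify ⟩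
    load φ v a c + count (((_≟ c) ∩? C?) ∪? (Inside? c b ∩? C?))
      ≤⟨ +-monoʳ-≤ (load φ v a c) (count-∪ ((_≟ c) ∩? C?) (Inside? c b ∩? C?)) ⟩
    load φ v a c + (count ((_≟ c) ∩? C?) + load φ v c b)
      ≡⟨ cong (λ x → load φ v a c + (x + load φ v c b)) (count-at C? c) ⟩
    load φ v a c + (𝟙 (conflict φ v c) + load φ v c b) ∎
    where
    C? = Conflict? φ v
    classify : Inside a b ∩ Conflict φ v ⊆
               (Inside a c ∩ Conflict φ v) ∪ ((_≡ c) ∩ Conflict φ v) ∪ (Inside c b ∩ Conflict φ v)
    classify (u∈ , cf) with Inside-split c∈ u∈
    ... | inj₁ u∈ac        = inj₁ (u∈ac , cf)
    ... | inj₂ (inj₁ u≡c)  = inj₂ (inj₁ (u≡c , cf))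
    ... | inj₂ (inj₂ u∈cb) = inj₂ (inj₂ (u∈cb , cf))

  load-unreachable : ∀ {φ v a b} → (∀ {u} → Inside a b u → adj G v u ≢ true) → load φ v a b ≡ 0
  load-unreachable {φ} {v} {a} {b} unreachable =
    count-empty (Inside? a b ∩? Conflict? φ v) λ u (u∈ , c) → unreachable u∈ (Conflict⇒adj c)

  load-local : ∀ {φ ψ v a b} → φ v ≡ ψ v → (∀ {u} → Inside a b u → φ u ≡ ψ u) → load φ v a b ≡ load ψ v a b
  load-local {φ} {ψ} {v} {a} {b} φv≡ψv agree =
    count-cong (Inside? a b ∩? Conflict? φ v) (Inside? a b ∩? Conflict? ψ v)
      (transport φv≡ψv agree) (transport (sym φv≡ψv) (sym ∘ agree))
    where
    transport : ∀ {φ ψ} → φ v ≡ ψ v → (∀ {u} → Inside a b u → φ u ≡ ψ u) →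
                Inside a b ∩ Conflict φ v ⊆ Inside a b ∩ Conflict ψ v
    transport φv≡ψv agree {u} (u∈ , c) = u∈ , subst T (cong₂ (λ x y → conf H v x u y) φv≡ψv (agree u∈)) c

  left-load-split : ∀ {ψ a b c} → Inside a b c → Closed c b → load ψ a a b ≤ load ψ a a c + 𝟙 (conflict ψ a c)
  left-load-split {ψ} {a} {b} {c} c∈ closed-cb = begin
    load ψ a a b                                        ≤⟨ load-split c∈ ⟩
    load ψ a a c + (𝟙 (conflict ψ a c) + load ψ a c b)  ≡⟨ cong (λ x → load ψ a a c + (𝟙 _ + x)) none-right ⟩
    load ψ a a c + (𝟙 (conflict ψ a c) + 0)             ≡⟨ cong (load ψ a a c +_) (+-identityʳ _) ⟩
    load ψ a a c + 𝟙 (conflict ψ a c)                   ∎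
    where
    none-right : load ψ a c b ≡ 0
    none-right = load-unreachable (closed-unreachable-before closed-cb (proj₁ c∈))

  right-load-split : ∀ {ψ a b c} → Inside a b c → Closed a c →
                     load ψ b a b ≤ 𝟙 (conflict ψ b c) + load ψ b c b
  right-load-split {ψ} {a} {b} {c} c∈ closed-ac = begin
    load ψ b a b                                        ≤⟨ load-split c∈ ⟩
    load ψ b a c + (𝟙 (conflict ψ b c) + load ψ b c b)  ≡⟨ cong (_+ _) none-left ⟩
    𝟙 (conflict ψ b c) + load ψ b c b                   ∎
    where
    none-left : load ψ b a c ≡ 0
    none-left = load-unreachable (closed-unreachable-after closed-ac (proj₂ c∈))

  middle-degree : ∀ {ψ a b c} → Closed a b → Inside a b c →
                  degree ψ c ≤ load ψ c a c + load ψ c c b + (𝟙 (conflict ψ c a) + 𝟙 (conflict ψ c b))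
  middle-degree {ψ} {a} {b} {c} closed c∈ = begin
    degree ψ c
      ≤⟨ degree-within (λ cf → closed c∈ (Conflict⇒adj cf)) ⟩
    load ψ c a b + ends
      ≤⟨ +-monoˡ-≤ ends (load-split c∈) ⟩
    load ψ c a c + (𝟙 (conflict ψ c c) + load ψ c c b) + ends
      ≡⟨ cong (λ x → load ψ c a c + (𝟙 x + load ψ c c b) + ends) (conflict-irrefl ψ c) ⟩
    load ψ c a c + load ψ c c b + ends ∎
    where
    ends = 𝟙 (conflict ψ c a) + 𝟙 (conflict ψ c b)

  record Recolouring (a b : Fin (n G)) (φ : Colouring H) (s : End) : Set where
    field
      colouring     : Colouring H
      fixed-outside : ∀ {u} → ¬ Inside a b u → colouring u ≡ φ u
      inner-degree  : ∀ {u} → Inside a b u → degree colouring u ≤ 3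
      left-load     : load colouring a a b ≤ budget s left
      right-load    : load colouring b a b ≤ budget s right
  open Recolouring

  recolour-empty : ∀ {a b} → (∀ u → ¬ Inside a b u) → ∀ φ s → Recolouring a b φ s
  recolour-empty empty φ s = record
    { colouring     = φ
    ; fixed-outside = λ _ → refl
    ; inner-degree  = λ u∈ → contradiction u∈ (empty _)
    ; left-load     = ≤-trans (≤-reflexive (load-unreachable λ u∈ → contradiction u∈ (empty _))) z≤n
    ; right-load    = ≤-trans (≤-reflexive (load-unreachable λ u∈ → contradiction u∈ (empty _))) z≤n
    }

  degree-unaffected : ∀ {ψ ψ′ a b c u} → Closed a c → (∀ {w} → ¬ Inside c b w → ψ w ≡ ψ′ w) →
                      Inside a c u → degree ψ u ≡ degree ψ′ u
  degree-unaffected closed-ac same u∈ =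
    degree-local (same (Inside-disjoint u∈)) (λ uw → same (outside-before (proj₂ (closed-ac u∈ uw))))

  load-unaffected : ∀ {ψ ψ′ a b c v} → (∀ {w} → ¬ Inside c b w → ψ w ≡ ψ′ w) →
                    ¬ Inside c b v → load ψ v a c ≡ load ψ′ v a c
  load-unaffected same v∉ = load-local (same v∉) (same ∘ Inside-disjoint)

  middle-colour : 2 ≤ k → ∀ (φ : Colouring H) a b c s →
                  Σ[ x ∈ Fin (size H c) ]
                    protected-conflict s (conf H c x a (φ a)) (conf H c x b (φ b)) ≡ false
  middle-colour 2≤k φ a b c left  = avoiding-colour 2≤k c a (φ a)
  middle-colour 2≤k φ a b c right = avoiding-colour 2≤k c b (φ b)

  module Consecutive {a b c φ s₁ s₂} (c∈ : Inside a b c)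
                     (r₁ : Recolouring a c φ s₁) (r₂ : Recolouring c b (colouring r₁) s₂) where

    fixed-outside-both : ∀ {u} → ¬ Inside a c u → ¬ Inside c b u → colouring r₂ u ≡ φ u
    fixed-outside-both ∉ac ∉cb = trans (fixed-outside r₂ ∉cb) (fixed-outside r₁ ∉ac)

    fixed-a : colouring r₂ a ≡ φ a
    fixed-a = fixed-outside-both (outside-before ≤-refl) (outside-before (<⇒≤ (proj₁ c∈)))

    fixed-b : colouring r₂ b ≡ φ b
    fixed-b = fixed-outside-both (outside-after (<⇒≤ (proj₂ c∈))) (outside-after ≤-refl)

    fixed-c : colouring r₂ c ≡ φ c
    fixed-c = fixed-outside-both (outside-after ≤-refl) (outside-before ≤-refl)

    first-half-load-a : load (colouring r₂) a a c ≤ budget s₁ left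
    first-half-load-a = ≤-trans (≤-reflexive (load-unaffected (fixed-outside r₂) (outside-before (<⇒≤ (proj₁ c∈)))))
                          (left-load r₁)

    first-half-load-c : load (colouring r₂) c a c ≤ budget s₁ right
    first-half-load-c = ≤-trans (≤-reflexive (load-unaffected (fixed-outside r₂) (outside-before ≤-refl))) (right-load r₁)

    first-half-degree : Closed a c → ∀ {u} → Inside a c u → degree (colouring r₂) u ≤ 3
    first-half-degree closed-ac u∈ =
      ≤-trans (≤-reflexive (degree-unaffected closed-ac (fixed-outside r₂) u∈)) (inner-degree r₁ u∈)

  recolour-split : 2 ≤ k → ∀ {a b c} → Closed a b → Inside a b c → Closed a c → Closed c b →
                   (∀ φ s → Recolouring a c φ s) → (∀ φ s → Recolouring c b φ s) →
                   ∀ φ s → Recolouring a b φ s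
  recolour-split 2≤k {a} {b} {c} closed c∈ closed-ac closed-cb recolour-ac recolour-cb φ s = record
    { colouring     = φ₃
    ; fixed-outside = λ u∉ → trans (fixed-outside-both (u∉ ∘ Inside-left c∈) (u∉ ∘ Inside-right c∈))
                                   (update-other φ x λ { refl → u∉ c∈ })
    ; inner-degree  = inner-degree′
    ; left-load     = ≤-trans (left-load-split c∈ closed-cb)
                        (≤-trans (+-mono-≤ first-half-load-a (≤-reflexive (cong 𝟙 (trans (conflict-sym φ₃ a c) ca))))
                                 (proj₁ budgets))
    ; right-load    = ≤-trans (right-load-split c∈ closed-ac)
                        (≤-trans (+-mono-≤ (≤-reflexive (cong 𝟙 (trans (conflict-sym φ₃ b c) cb))) (right-load r₂))
                                 (proj₁ (proj₂ budgets)))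
    }
    where
    x : Fin (size H c)
    x = proj₁ (middle-colour 2≤k φ a b c s)
    ea eb : Bool
    ea = conf H c x a (φ a)
    eb = conf H c x b (φ b)
    budgets = budget-split s ea eb (proj₂ (middle-colour 2≤k φ a b c s))
    r₁ : Recolouring a c (φ [ c ≔ x ]) (left-protection s ea)
    r₁ = recolour-ac (φ [ c ≔ x ]) (left-protection s ea)
    r₂ : Recolouring c b (colouring r₁) (right-protection s eb)
    r₂ = recolour-cb (colouring r₁) (right-protection s eb)
    φ₃ : Colouring H
    φ₃ = colouring r₂
    open Consecutive c∈ r₁ r₂
    φ₃c : φ₃ c ≡ x
    φ₃c = trans fixed-c (update-same φ c x)
    ca : conflict φ₃ c a ≡ ea
    ca = cong₂ (λ y z → conf H c y a z) φ₃c (trans fixed-a (update-other φ x λ { refl → outside-before ≤-refl c∈ }))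
    cb : conflict φ₃ c b ≡ eb
    cb = cong₂ (λ y z → conf H c y b z) φ₃c (trans fixed-b (update-other φ x λ { refl → outside-after ≤-refl c∈ }))
    inner-degree′ : ∀ {u} → Inside a b u → degree φ₃ u ≤ 3
    inner-degree′ u∈ with Inside-split c∈ u∈
    ... | inj₁ u∈ac        = first-half-degree closed-ac u∈ac
    ... | inj₂ (inj₂ u∈cb) = inner-degree r₂ u∈cb
    ... | inj₂ (inj₁ refl) = ≤-trans (middle-degree closed c∈)
                               (≤-trans (+-mono-≤ (+-mono-≤ first-half-load-c (left-load r₂))
                                                  (≤-reflexive (cong₂ _+_ (cong 𝟙 ca) (cong 𝟙 cb))))
                                        (proj₂ (proj₂ budgets)))

  recolour : 2 ≤ k → ∀ fuel {a b} → pos b ≤ fuel + pos a → Closed a b → ∀ φ s → Recolouring a b φ s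
  recolour 2≤k zero b≤a closed = recolour-empty λ u (a<u , u<b) → <⇒≱ (<-trans a<u u<b) b≤a
  recolour 2≤k (suc fuel) {a} {b} b≤ closed with split closed
  ... | inj₁ empty = recolour-empty empty
  ... | inj₂ (c , c∈@(a<c , c<b) , closed-ac , closed-cb) =
    recolour-split 2≤k closed c∈ closed-ac closed-cb
      (recolour 2≤k fuel c≤ closed-ac) (recolour 2≤k fuel b≤′ closed-cb)
    where
    c≤ : pos c ≤ fuel + pos a
    c≤ = ≤-pred (≤-trans c<b b≤)
    b≤′ : pos b ≤ fuel + pos c
    b≤′ = ≤-trans b≤ (≤-trans (≤-reflexive (sym (+-suc fuel (pos a)))) (+-monoʳ-≤ fuel a<c))

  defective-colouring : 2 ≤ k → Σ[ φ ∈ Colouring H ] ∀ v → degree φ v ≤ 3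
  defective-colouring 2≤k with minimum? U? pos | maximum? U? pos
  ... | inj₂ no-vertex | _              = (λ v → ⊥-elim (no-vertex v _)) , λ v → ⊥-elim (no-vertex v _)
  ... | inj₁ (f , _)   | inj₂ no-vertex = ⊥-elim (no-vertex f _)
  ... | inj₁ (f , _ , f-first) | inj₁ (l , _ , l-last) = φ , degree≤3
    where
    spans : ∀ {u} → pos f ≤ pos u × pos u ≤ pos l
    spans = f-first _ , l-last _
    φ₀ : Colouring H
    φ₀ v = proj₁ (two-distinct (≤-trans 2≤k (k-fold H v)))
    r : Recolouring f l φ₀ left
    r = recolour 2≤k (pos l) (m≤m+n (pos l) (pos f)) (λ _ _ → spans) φ₀ left
    φ : Colouring H
    φ = colouring r
    end-degree : ∀ {v} → load φ v f l ≤ 1 → degree φ v ≤ 3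
    end-degree load≤1 = ≤-trans (degree-within λ _ → spans)
                                (+-mono-≤ load≤1 (+-mono-≤ (𝟙≤1 (conflict φ _ f)) (𝟙≤1 (conflict φ _ l))))
    degree≤3 : ∀ v → degree φ v ≤ 3
    degree≤3 v with between (proj₁ (spans {v})) (proj₂ (spans {v}))
    ... | inj₁ v∈          = inner-degree r v∈
    ... | inj₂ (inj₁ refl) = end-degree (≤-trans (left-load r) z≤n)
    ... | inj₂ (inj₂ refl) = end-degree (right-load r)

outerplanar-3-defective : ∀ {k} → 2 ≤ k → (G : Graph) → Outerplanar G → DefectiveCorrespondable 3 k G
outerplanar-3-defective 2≤k G outerplanar H with IntervalRecolouring.defective-colouring outerplanar H 2≤k
... | φ , degree≤3 = φ , λ v → subst (_≤ 3) (sym (imageDegree≡degree φ v)) (degree≤3 v)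
  where open Conflicts H

module Counterexample where

  data Site : Set where
    centre : Site
    gadget : Fin 3 → Fin 5 → Site

  -- Vertex 0 is the hub and vertex 1 + 5g + j is vertex j of gadget g.
  site : Fin 16 → Site
  site zero    = centre
  site (suc i) = uncurry gadget (remQuot 5 i)

  hub : Fin 16
  hub = zero

  node : Fin 3 → Fin 5 → Fin 16
  node g j = suc (combine g j)

  gadget-edge : Fin 5 → Fin 5 → Bool
  gadget-edge 0F 1F = true
  gadget-edge 1F 2F = true
  gadget-edge 2F 3F = true
  gadget-edge 3F 4F = true
  gadget-edge 1F 3F = true
  gadget-edge _  _  = false

  spoke : Fin 5 → Bool
  spoke 2F = false
  spoke _  = true

  twist : Fin 5 → Fin 5 → Bool
  twist 1F 2F = true
  twist 2F 1F = true
  twist _  _  = false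

  link : Site → Site → Bool
  link centre       centre       = false
  link centre       (gadget _ j) = spoke j
  link (gadget _ i) centre       = spoke i
  link (gadget g i) (gadget h j) = does (g ≟ h) ∧ (gadget-edge i j ∨ gadget-edge j i)

  twisted : Site → Site → Bool
  twisted (gadget _ i) (gadget _ j) = twist i j
  twisted _            _            = false

  adjacent : Fin 16 → Fin 16 → Bool
  adjacent u v = link (site u) (site v)

  conflicting : Fin 16 → Fin 2 → Fin 16 → Fin 2 → Bool
  conflicting u x v y = adjacent u v ∧ (does (x ≟ y) xor twisted (site u) (site v))

  G : Graph
  G = record
    { n      = 16
    ; adj    = adjacent
    ; sym    = from-yes (all? λ u → all? λ v → adjacent u v ≟ᵇ adjacent v u)
    ; irrefl = from-yes (all? λ u → adjacent u u ≟ᵇ false)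
    }

  noncrossing : ∀ a b → adjacent a b ≡ true → ∀ c d → adjacent c d ≡ true →
                ¬ (toℕ a < toℕ c × toℕ c < toℕ b × toℕ b < toℕ d)
  noncrossing = from-yes (all? λ a → all? λ b → (adjacent a b ≟ᵇ true) →-dec all? λ c → all? λ d →
    (adjacent c d ≟ᵇ true) →-dec ¬? (toℕ a <? toℕ c ×-dec toℕ c <? toℕ b ×-dec toℕ b <? toℕ d))

  outerplanar : Outerplanar G
  outerplanar = id , id , λ a b c d ab cd → noncrossing a b ab c d cd

  cover : Cover G 2
  cover = record
    { size     = λ _ → 2
    ; k-fold   = λ _ → ≤-refl
    ; conf     = conflicting
    ; conf-sym = from-yes (all? λ u → all? λ x → all? λ v → all? λ y →
                   conflicting u x v y ≟ᵇ conflicting v y u x)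
    ; indep    = from-yes (all? λ v → all? λ x → all? λ y → conflicting v x v y ≟ᵇ false)
    ; matching = from-yes (all? λ u → all? λ x → all? λ v → all? λ y → all? λ y′ →
                   (conflicting u x v y ≟ᵇ true) →-dec (conflicting u x v y′ ≟ᵇ true) →-dec y ≟ y′)
    ; nonadj   = λ u x v y uv → cong (_∧ (does (x ≟ y) xor twisted (site u) (site v))) uv
    }

  uniform : Fin 2 → (Fin 5 → Fin 2) → Colouring cover
  uniform h x = colour ∘ site
    where
    colour : Site → Fin 2
    colour centre       = h
    colour (gadget _ j) = x j

  spoke-indicators : Colouring cover → Fin 3 → List ℕ
  spoke-indicators φ g =
    map (λ j → 𝟙 (conflicting hub (φ hub) (node g j) (φ (node g j)))) (0F ∷ 1F ∷ 3F ∷ 4F ∷ [])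

  spoke-conflicts : Colouring cover → Fin 3 → ℕ
  spoke-conflicts φ g = sum (spoke-indicators φ g)

  uniform-spoke-conflict : ∀ g h x₀ x₁ x₂ x₃ x₄ → let ψ = uniform h (x₀ ∷ᵛ x₁ ∷ᵛ x₂ ∷ᵛ x₃ ∷ᵛ x₄ ∷ᵛ []ᵛ) in
    imageDegree cover ψ (node g 1F) ≤ 2 → imageDegree cover ψ (node g 3F) ≤ 2 → 1 ≤ spoke-conflicts ψ g
  uniform-spoke-conflict = from-yes
    (all? λ g → all? λ h → all? λ x₀ → all? λ x₁ → all? λ x₂ → all? λ x₃ → all? λ x₄ →
      let ψ = uniform h (x₀ ∷ᵛ x₁ ∷ᵛ x₂ ∷ᵛ x₃ ∷ᵛ x₄ ∷ᵛ []ᵛ) in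
      imageDegree cover ψ (node g 1F) ≤? 2 →-dec imageDegree cover ψ (node g 3F) ≤? 2 →-dec
      1 ≤? spoke-conflicts ψ g)

  copy-gadget : Colouring cover → Fin 3 → Colouring cover
  copy-gadget φ g =
    uniform (φ hub) (φ (node g 0F) ∷ᵛ φ (node g 1F) ∷ᵛ φ (node g 2F) ∷ᵛ φ (node g 3F) ∷ᵛ φ (node g 4F) ∷ᵛ []ᵛ)

  copy-spoke-conflict : ∀ φ g → let ψ = copy-gadget φ g in
    imageDegree cover ψ (node g 1F) ≤ 2 → imageDegree cover ψ (node g 3F) ≤ 2 → 1 ≤ spoke-conflicts ψ g
  copy-spoke-conflict φ g = uniform-spoke-conflict g (φ hub)
    (φ (node g 0F)) (φ (node g 1F)) (φ (node g 2F)) (φ (node g 3F)) (φ (node g 4F))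

  -- For a literal g, both sides of each argument and of the result compute to the same expression in the
  -- colours of the hub and of gadget g, so φ may be replaced by copy-gadget φ g.
  spoke-conflict : ∀ φ → Defective cover 2 φ → ∀ g → 1 ≤ spoke-conflicts φ g
  spoke-conflict φ defective 0F = copy-spoke-conflict φ 0F (defective (node 0F 1F)) (defective (node 0F 3F))
  spoke-conflict φ defective 1F = copy-spoke-conflict φ 1F (defective (node 1F 1F)) (defective (node 1F 3F))
  spoke-conflict φ defective 2F = copy-spoke-conflict φ 2F (defective (node 2F 1F)) (defective (node 2F 3F))

  -- imageDegree at the hub computes to the sum of the concatenated spoke indicators.
  hub-degree : ∀ φ →
    imageDegree cover φ hub ≡ spoke-conflicts φ 0F + (spoke-conflicts φ 1F + spoke-conflicts φ 2F)
  hub-degree φ = trans (sum-++ (spoke-indicators φ 0F) (spoke-indicators φ 1F ++ spoke-indicators φ 2F))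
                       (cong (spoke-conflicts φ 0F +_) (sum-++ (spoke-indicators φ 1F) (spoke-indicators φ 2F)))

  not-2-defective : ¬ DefectiveCorrespondable 2 2 G
  not-2-defective correspondable with correspondable cover
  ... | φ , defective = <⇒≱ three-conflicts (subst (_≤ 2) (hub-degree φ) (defective hub))
    where
    three-conflicts : 3 ≤ spoke-conflicts φ 0F + (spoke-conflicts φ 1F + spoke-conflicts φ 2F)
    three-conflicts = +-mono-≤ (spoke-conflict φ defective 0F)
                        (+-mono-≤ (spoke-conflict φ defective 1F) (spoke-conflict φ defective 2F))

theorem1p5 : ((G : Graph) → Outerplanar G → DefectiveCorrespondable 3 2 G)
             × Σ Graph (λ G → Outerplanar G × ¬ DefectiveCorrespondable 2 2 G)
theorem1p5 = outerplanar-3-defective ≤-refl , (G , outerplanar , not-2-defective)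
  where open Counterexample
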